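{- Let $G=(V,E,w)$ be a weighted undirected graph with conductance $\Phi_G$, and let $\mathcal{T}$ be any HC tree of $G$. Let $(A_0,A_1,\dots,A_k)$, $k\ge 0$, be the dense branch of $\mathcal{T}$, and for $1\le i\le k$ let $B_i$ be the sibling of $A_i$. Then \begin{enumerate} \item $\mathrm{cost}_G(\mathcal{T}) \ge \frac{\Phi_G}{2}\sum_{i=1}^k |A_{i-1}|\cdot \mathrm{vol}(B_i)$; \item $\mathrm{cost}_G(\mathcal{T}) \ge \frac{\Phi_G}{2}\cdot |A_k|\cdot \mathrm{vol}(A_k)$. \end{enumerate}
   Context: $d_u=\sum_v w_{uv}$, $\mathrm{vol}(S)=\sum_{u\in S}d_u$, $\mathrm{vol}(G)=\mathrm{vol}(V)$, $w(S,T)$ is the total weight of edges between disjoint $S,T$, and $\Phi_G=\min\{w(S,V\setminus S)/\mathrm{vol}(S): \emptyset\neq S\subset V,\ \mathrm{vol}(S)\le\mathrm{vol}(V)/2\}$. An HC tree is a rooted binary tree with leaves in bijection with $V$; each node is identified with the set of vertices at the leaves below it, and $|N|$ denotes that set's size. $\mathrm{cost}_G(\mathcal{T})=\sum_{e=\{u,v\}\in E} w_e\cdot|\mathsf{leaves}(\mathcal{T}[u\vee v])|$ with $u\vee v$ the lowest common ancestor. The dense branch of $\mathcal{T}$ is the path $(A_0,\dots,A_k)$ where $A_0$ is the root, each $A_{i+1}$ is the child of $A_i$ of higher volume, and $A_k$ is the node with $\mathrm{vol}(A_k)>\mathrm{vol}(G)/2$ both of whose children have volume at most $\mathrm{vol}(G)/2$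 (equivalently, the dense branch consists of all nodes of volume greater than $\mathrm{vol}(G)/2$).
   Formalization: The edge weights of G, and with them $\Phi_G$, the volumes and the cost, are rational rather than real. -}

module Defs where

open import Data.Bool using (Bool; true; false; if_then_else_)
open import Data.Nat as ℕ using (ℕ)
open import Data.Integer using (+_)
open import Data.Rational using (ℚ; 0ℚ; _+_; _*_; _≤_; _<_; _/_)
open import Data.Fin using (Fin; toℕ)
open import Data.Fin.Subset using (Subset; _∈_; _∉_; ∁; Nonempty)
open import Data.Vec using (lookup)
open import Data.List using (List; []; _∷_; foldr; map; length; _++_)
open import Data.List.Membership.Propositional renaming (_∈_ to _∈ₗ_)
import Data.List.Membership.DecPropositional as DecMem
open import Data.Fin using (_≟_)
open import Data.List.Relation.Unary.Unique.Propositional using (Unique)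
open import Data.Fin.Base using () renaming (_<_ to _<ᶠ_)
open import Data.Nat.Base using (_<ᵇ_)
open import Data.Product using (Σ; _×_; _,_; ∃)
open import Data.Sum using (_⊎_)
open import Relation.Nullary using (¬_; yes; no)
open import Relation.Binary.PropositionalEquality using (_≡_)

ℕ→ℚ : ℕ → ℚ
ℕ→ℚ k = (+ k) / 1

sumℚ : List ℚ → ℚ
sumℚ = foldr _+_ 0ℚ

Σ[_] : {n : ℕ} → (Fin n → ℚ) → ℚ
Σ[_] {n} f = sumℚ (map f (Data.List.allFin n))

-- Weighted undirected graphs on vertex set V = Fin n
-- (nonnegative rational weights, symmetric, no self-loops;
--  w u v = 0 means "no edge")

record WGraph (n : ℕ) : Set where
  field
    w       : Fin n → Fin n → ℚ
    w-nonneg : ∀ u v → 0ℚ ≤ w u v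
    w-sym   : ∀ u v → w u v ≡ w v u
    w-noloop : ∀ u → w u u ≡ 0ℚ
open WGraph public

module _ {n : ℕ} (G : WGraph n) where

  deg : Fin n → ℚ
  deg u = Σ[ (λ v → w G u v) ]

  volS : Subset n → ℚ
  volS S = Σ[ (λ u → if lookup S u then deg u else 0ℚ) ]

  volG : ℚ
  volG = Σ[ deg ]

  wST : Subset n → Subset n → ℚ
  wST S T = Σ[ (λ u → if lookup S u
                 then Σ[ (λ v → if lookup T v then w G u v else 0ℚ) ]
                 else 0ℚ) ]

  -- admissible sets in the definition of Φ_G:
  -- ∅ ≠ S ⊊ V and vol(S) ≤ vol(V)/2  (written 2·vol(S) ≤ vol(V))
  Admissible : Subset n → Set
  Admissible S = Nonempty S × Nonempty (∁ S) × (ℕ→ℚ 2 * volS S ≤ volG)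

  -- φ is the conductance Φ_G = min over admissible S of w(S, V∖S)/vol(S):
  -- φ is a lower bound of all these ratios (stated multiplicatively,
  -- φ·vol(S) ≤ w(S,V∖S)), and the minimum is attained by some admissible S
  -- (with vol(S) > 0, so that the ratio is defined and equals φ).
  IsConductance : ℚ → Set
  IsConductance φ =
    (∀ S → Admissible S → φ * volS S ≤ wST S (∁ S)) ×
    ∃ λ S → Admissible S × (0ℚ < volS S) × (φ * volS S ≡ wST S (∁ S))

-- Hierarchical clustering trees: full rooted binary trees with leaves
-- labelled by vertices; each node is identified with its set of leaves.

data Tree (n : ℕ) : Set where
  leaf : Fin n → Tree n
  node : Tree n → Tree n → Tree n

leaves : {n : ℕ} → Tree n → List (Fin n)
leaves (leaf v)   = v ∷ []
leaves (node l r) = leaves l ++ leaves r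

size : {n : ℕ} → Tree n → ℕ
size t = length (leaves t)

IsHCTree : {n : ℕ} → Tree n → Set
IsHCTree {n} t = Unique (leaves t) × (∀ (v : Fin n) → v ∈ₗ leaves t)

lcaSize : {n : ℕ} → Tree n → Fin n → Fin n → ℕ
lcaSize (leaf x) u v = 1
lcaSize {n} (node l r) u v with DecMem._∈?_ (_≟_ {n}) u (leaves l) | DecMem._∈?_ (_≟_ {n}) v (leaves l) | DecMem._∈?_ (_≟_ {n}) u (leaves r) | DecMem._∈?_ (_≟_ {n}) v (leaves r)
... | yes _ | yes _ | _     | _     = lcaSize l u v
... | _     | _     | yes _ | yes _ = lcaSize r u v
... | _     | _     | _     | _     = size (node l r)

module _ {n : ℕ} (G : WGraph n) where

  volT : Tree n → ℚ
  volT t = sumℚ (map (deg G) (leaves t))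

  cost : Tree n → ℚ
  cost t = Σ[ (λ u → Σ[ (λ v →
             if toℕ u <ᵇ toℕ v then w G u v * ℕ→ℚ (lcaSize t u v) else 0ℚ) ]) ]

  -- DenseFrom A ps Ak : the dense branch starting at node A is
  -- (A = A_j, A_{j+1}, ..., A_k = Ak), and ps lists the pairs
  -- (A_{i-1}, B_i) for the steps, B_i the sibling of A_i.
  -- "vol(N) > vol(G)/2" is written  vol(G) < 2·vol(N).
  data DenseFrom : Tree n → List (Tree n × Tree n) → Tree n → Set where
    stop-leaf : ∀ x → volG G < ℕ→ℚ 2 * volT (leaf x) →
                DenseFrom (leaf x) [] (leaf x)
    stop-node : ∀ l r → volG G < ℕ→ℚ 2 * volT (node l r) →
                ℕ→ℚ 2 * volT l ≤ volG G → ℕ→ℚ 2 * volT r ≤ volG G →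
                DenseFrom (node l r) [] (node l r)
    step-l : ∀ l r ps Ak → volG G < ℕ→ℚ 2 * volT (node l r) →
             volT r ≤ volT l → volG G < ℕ→ℚ 2 * volT l →
             DenseFrom l ps Ak →
             DenseFrom (node l r) ((node l r , r) ∷ ps) Ak
    step-r : ∀ l r ps Ak → volG G < ℕ→ℚ 2 * volT (node l r) →
             volT l ≤ volT r → volG G < ℕ→ℚ 2 * volT r →
             DenseFrom r ps Ak →
             DenseFrom (node l r) ((node l r , l) ∷ ps) Ak

  DenseBranch : Tree n → List (Tree n × Tree n) → Tree n → Set
  DenseBranch t = DenseFrom t

  branchSum : List (Tree n × Tree n) → ℚ
  branchSum ps = sumℚ (map (λ { (A , B) → ℕ→ℚ (size A) * volT B }) ps)

{-# OPTIONS --safe #-}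
module Submission where

-- Charging argument. If B is a child of a node A of T, every edge {u,v} with u ∈ B and v ∉ B
-- has its lowest common ancestor at or above A, so it pays at least |A| in cost(T). When the
-- sets B of a family of such pairs (A, B) are pairwise disjoint, every ordered pair (u,v) is
-- charged by at most one of them, hence Σ |A|·w(B, V∖B) ≤ 2·cost(T) (cost counts each edge
-- once). The siblings B_i of the dense branch form such a family, and vol(B_i) ≤ vol(G)/2
-- makes B_i admissible for Φ_G, so Φ_G·vol(B_i) ≤ w(B_i, V∖B_i): this gives (1). For (2) use
-- the two children of A_k, light by the choice of A_k; if A_k is a leaf, Φ_G ≤ 1 and
-- vol(A_k) ≤ vol(G) ≤ 2·cost(T).

open import Defs
open import Data.Bool using (Bool; true; false; not; _∧_; if_then_else_)
open import Data.Nat as ℕ using (ℕ; zero; suc)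
import Data.Nat.Properties as ℕ
import Data.Nat.Coprimality as Coprime
import Data.Integer as ℤ
import Data.Integer.Properties as ℤ
open import Data.Rational using (ℚ; 0ℚ; 1ℚ; ½; _+_; _*_; _≤_; *≤*; nonNegative; positive)
open import Data.Rational.Properties hiding (_≟_)
open import Data.Rational.Solver using (module +-*-Solver)
open import Data.Fin using (Fin; zero; suc; _≟_; toℕ)
open import Data.Fin.Properties using (toℕ-injective)
open import Data.Fin.Subset using (Subset; ∁; Nonempty) renaming (_∈_ to _∈ₛ_)
open import Data.Vec using (lookup; tabulate)
open import Data.Vec.Properties using (lookup∘tabulate; lookup-map; lookup⇒[]=)
open import Data.List as List using (List; []; _∷_; _++_; map)
open import Data.List.Properties using (map-tabulate; map-cong; length-++)
open import Data.List.Relation.Unary.All as All using (All; []; _∷_)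
import Data.List.Relation.Unary.All.Properties as All
open import Data.List.Relation.Unary.AllPairs using (AllPairs; []; _∷_)
open import Data.List.Relation.Unary.Any using (here; there)
open import Data.List.Relation.Unary.Unique.Propositional using (Unique)
open import Data.List.Relation.Binary.Disjoint.Propositional using (Disjoint)
import Data.List.Relation.Binary.Disjoint.Propositional.Properties as Disjoint
open import Data.List.Membership.Propositional using (_∈_; _∉_)
open import Data.List.Membership.Propositional.Properties using (∈-++⁺ˡ; ∈-++⁺ʳ)
import Data.List.Membership.DecPropositional as DecMembership
open import Data.Product using (_×_; _,_; proj₁; proj₂; ∃; swap)
open import Data.Sum using (inj₁; inj₂)
open import Data.Empty using (⊥-elim)
open import Data.Unit using (⊤; tt)
open import Function using (_∘_; _on_)
open import Relation.Binary.Definitions using (tri<; tri≈; tri>)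
open import Relation.Binary.PropositionalEquality
open import Relation.Nullary using (¬_; Dec; yes; no; does; _×-dec_)
open import Relation.Nullary.Decidable using (dec-true; dec-false; toSum)
open import Algebra.Bundles using (CommutativeRing; CommutativeMonoid)
open import Algebra.Properties.CommutativeSemigroup
  (CommutativeMonoid.commutativeSemigroup *-1-commutativeMonoid) using (x∙yz≈y∙xz)
open import Algebra.Properties.Semiring.Sum (CommutativeRing.semiring +-*-commutativeRing)
  using (sum; sum-cong-≗; sum-replicate-zero; ∑-comm; ∑-distrib-+; *-distribˡ-sum)

open +-*-Solver using (solve; _:+_; _:*_; _:=_; con)

ℕ→ℚ-mono-≤ : ∀ {a b} → a ℕ.≤ b → ℕ→ℚ a ≤ ℕ→ℚ b
ℕ→ℚ-mono-≤ {a} {b} a≤b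
  rewrite normalize-coprime (Coprime.sym (Coprime.1-coprimeTo a))
        | normalize-coprime (Coprime.sym (Coprime.1-coprimeTo b))
  = *≤* (subst₂ ℤ._≤_ (sym (ℤ.*-identityʳ (ℤ.+ a))) (sym (ℤ.*-identityʳ (ℤ.+ b)))
                      (ℤ.+≤+ a≤b))

ℕ→ℚ-nonNeg : ∀ a → 0ℚ ≤ ℕ→ℚ a
ℕ→ℚ-nonNeg a = ℕ→ℚ-mono-≤ {0} {a} ℕ.z≤n

*-monoˡ-≤-0≤ : ∀ {c x y} → 0ℚ ≤ c → x ≤ y → c * x ≤ c * y
*-monoˡ-≤-0≤ {c} 0≤c = *-monoˡ-≤-nonNeg c {{nonNegative 0≤c}}

halve-≤ : ∀ p x c → p * x ≤ c + c → (½ * p) * x ≤ c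
halve-≤ p x c px≤2c = begin
  (½ * p) * x ≡⟨ *-assoc ½ p x ⟩
  ½ * (p * x) ≤⟨ *-monoˡ-≤-nonNeg ½ px≤2c ⟩
  ½ * (c + c) ≡⟨ solve 1 (λ c → con ½ :* (c :+ c) := c) refl c ⟩
  c           ∎
  where open ≤-Reasoning

x≤y⇒x+y≤z⇒2x≤z : ∀ {x y z} → x ≤ y → x + y ≤ z → ℕ→ℚ 2 * x ≤ z
x≤y⇒x+y≤z⇒2x≤z {x} {y} {z} x≤y x+y≤z = begin
  ℕ→ℚ 2 * x ≡⟨ solve 1 (λ x → con (ℕ→ℚ 2) :* x := x :+ x) refl x ⟩
  x + x     ≤⟨ +-monoʳ-≤ x x≤y ⟩
  x + y     ≤⟨ x+y≤z ⟩
  z         ∎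
  where open ≤-Reasoning

infixr 8 [_]·_

[_]·_ : Bool → ℚ → ℚ
[ b ]· x = if b then x else 0ℚ

[]·-≤ : ∀ b {x} → 0ℚ ≤ x → [ b ]· x ≤ x
[]·-≤ true  _   = ≤-refl
[]·-≤ false 0≤x = 0≤x

[]·-mono-≤ : ∀ b {x y} → x ≤ y → [ b ]· x ≤ [ b ]· y
[]·-mono-≤ true  x≤y = x≤y
[]·-mono-≤ false _   = ≤-refl

*-[]·-comm : ∀ c b x → c * [ b ]· x ≡ x * [ b ]· c
*-[]·-comm c true  x = *-comm c x
*-[]·-comm c false x = trans (*-zeroʳ c) (sym (*-zeroʳ x))

[]·-∧ : ∀ a b x → [ a ]· [ b ]· x ≡ [ a ∧ b ]· x
[]·-∧ true  b x = refl
[]·-∧ false b x = refl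

Σ[]≡sum : ∀ {n} (f : Fin n → ℚ) → Σ[ f ] ≡ sum f
Σ[]≡sum f = trans (cong sumℚ (map-tabulate (λ i → i) f)) (sumℚ-tabulate f)
  where
  sumℚ-tabulate : ∀ {m} (g : Fin m → ℚ) → sumℚ (List.tabulate g) ≡ sum g
  sumℚ-tabulate {zero}  g = refl
  sumℚ-tabulate {suc m} g = cong (g zero +_) (sumℚ-tabulate (g ∘ suc))

sum-mono-≤ : ∀ {n} {f g : Fin n → ℚ} → (∀ i → f i ≤ g i) → sum f ≤ sum g
sum-mono-≤ {zero}  _   = ≤-refl
sum-mono-≤ {suc n} f≤g = +-mono-≤ (f≤g zero) (sum-mono-≤ (f≤g ∘ suc))

sum-nonNeg : ∀ {n} {f : Fin n → ℚ} → (∀ i → 0ℚ ≤ f i) → 0ℚ ≤ sum f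
sum-nonNeg {n} {f} 0≤f = subst (_≤ sum f) (sum-replicate-zero n) (sum-mono-≤ 0≤f)

[]·-sum : ∀ {n} b (f : Fin n → ℚ) → [ b ]· sum f ≡ sum (λ i → [ b ]· f i)
[]·-sum {n} true  f = refl
[]·-sum {n} false f = sym (sum-replicate-zero n)

Σ[]-mono-≤ : ∀ {n} {f g : Fin n → ℚ} → (∀ i → f i ≤ g i) → Σ[ f ] ≤ Σ[ g ]
Σ[]-mono-≤ {f = f} {g} f≤g = subst₂ _≤_ (sym (Σ[]≡sum f)) (sym (Σ[]≡sum g)) (sum-mono-≤ f≤g)

Σ[]-nonNeg : ∀ {n} {f : Fin n → ℚ} → (∀ i → 0ℚ ≤ f i) → 0ℚ ≤ Σ[ f ]
Σ[]-nonNeg {f = f} 0≤f = subst (0ℚ ≤_) (sym (Σ[]≡sum f)) (sum-nonNeg 0≤f)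

sum-δ : ∀ {n} (x : Fin n) (f : Fin n → ℚ) → sum (λ i → [ does (i ≟ x) ]· f i) ≡ f x
sum-δ {suc n} zero    f = trans (cong (f zero +_) (sum-replicate-zero n)) (+-identityʳ (f zero))
sum-δ {suc n} (suc x) f = trans (+-identityˡ _) (sum-δ x (f ∘ suc))

-- Both hold by computation: does (m ℕ.<? k) reduces to m ℕ.<ᵇ k.
<ᵇ-true : ∀ {m k} → m ℕ.< k → (m ℕ.<ᵇ k) ≡ true
<ᵇ-true {m} {k} = dec-true (m ℕ.<? k)

<ᵇ-false : ∀ {m k} → ¬ m ℕ.< k → (m ℕ.<ᵇ k) ≡ false
<ᵇ-false {m} {k} = dec-false (m ℕ.<? k)

module _ {n : ℕ} (W : Fin n → Fin n → ℚ)
         (W-sym : ∀ u v → W u v ≡ W v u) (W-diag : ∀ u → W u u ≡ 0ℚ) where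

  private
    W< : Fin n → Fin n → ℚ
    W< u v = [ toℕ u ℕ.<ᵇ toℕ v ]· W u v

    split-ordered : ∀ u v → W u v ≡ W< u v + W< v u
    split-ordered u v with ℕ.<-cmp (toℕ u) (toℕ v)
    ... | tri< u<v _ v≮u rewrite <ᵇ-true u<v | <ᵇ-false v≮u = sym (+-identityʳ (W u v))
    ... | tri> u≮v _ v<u rewrite <ᵇ-false u≮v | <ᵇ-true v<u = trans (W-sym u v) (sym (+-identityˡ (W v u)))
    ... | tri≈ u≮v u≡v v≮u rewrite <ᵇ-false u≮v | <ᵇ-false v≮u | toℕ-injective u≡v =
      trans (W-diag v) (sym (+-identityʳ 0ℚ))

  sum-symmetric : sum (λ u → sum (W u)) ≡
                  sum (λ u → sum (λ v → [ toℕ u ℕ.<ᵇ toℕ v ]· W u v)) +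
                  sum (λ u → sum (λ v → [ toℕ u ℕ.<ᵇ toℕ v ]· W u v))
  sum-symmetric = begin
    sum (λ u → sum (W u))
      ≡⟨ sum-cong-≗ {n} (λ u → sum-cong-≗ {n} (split-ordered u)) ⟩
    sum (λ u → sum (λ v → W< u v + W< v u))
      ≡⟨ sum-cong-≗ {n} (λ u → ∑-distrib-+ (W< u) (λ v → W< v u)) ⟩
    sum (λ u → sum (W< u) + sum (λ v → W< v u))
      ≡⟨ ∑-distrib-+ (λ u → sum (W< u)) (λ u → sum (λ v → W< v u)) ⟩
    sum (λ u → sum (W< u)) + sum (λ u → sum (λ v → W< v u))
      ≡⟨ cong (sum (λ u → sum (W< u)) +_) (∑-comm (λ u v → W< v u)) ⟩
    sum (λ u → sum (W< u)) + sum (λ u → sum (W< u)) ∎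
    where open ≡-Reasoning

Σₗ : {A : Set} → (A → ℚ) → List A → ℚ
Σₗ f xs = sumℚ (map f xs)

module _ {A : Set} where

  Σₗ-cong : {f g : A → ℚ} (xs : List A) → (∀ x → f x ≡ g x) → Σₗ f xs ≡ Σₗ g xs
  Σₗ-cong xs f≡g = cong sumℚ (map-cong f≡g xs)

  Σₗ-mono-≤ : {f g : A → ℚ} {xs : List A} → All (λ x → f x ≤ g x) xs → Σₗ f xs ≤ Σₗ g xs
  Σₗ-mono-≤ []          = ≤-refl
  Σₗ-mono-≤ (fx≤gx ∷ p) = +-mono-≤ fx≤gx (Σₗ-mono-≤ p)

  Σₗ-++ : (f : A → ℚ) (xs ys : List A) → Σₗ f (xs ++ ys) ≡ Σₗ f xs + Σₗ f ys
  Σₗ-++ f []       ys = sym (+-identityˡ _)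
  Σₗ-++ f (x ∷ xs) ys = trans (cong (f x +_) (Σₗ-++ f xs ys)) (sym (+-assoc (f x) _ _))

  *-distribˡ-Σₗ : (c : ℚ) (f : A → ℚ) (xs : List A) → c * Σₗ f xs ≡ Σₗ (λ x → c * f x) xs
  *-distribˡ-Σₗ c f []       = *-zeroʳ c
  *-distribˡ-Σₗ c f (x ∷ xs) = trans (*-distribˡ-+ c (f x) _) (cong (c * f x +_) (*-distribˡ-Σₗ c f xs))

  Σₗ-sum-comm : ∀ {n} (f : A → Fin n → ℚ) (xs : List A) →
                Σₗ (λ x → sum (f x)) xs ≡ sum (λ i → Σₗ (λ x → f x i) xs)
  Σₗ-sum-comm {n} f []       = sym (sum-replicate-zero n)
  Σₗ-sum-comm     f (x ∷ xs) =
    trans (cong (sum (f x) +_) (Σₗ-sum-comm f xs)) (sym (∑-distrib-+ (f x) _))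

module _ {n : ℕ} where

  open DecMembership (_≟_ {n}) using (_∈?_)

  sum-∈ : {xs : List (Fin n)} (f : Fin n → ℚ) → Unique xs →
          sum (λ i → [ does (i ∈? xs) ]· f i) ≡ Σₗ f xs
  sum-∈ {[]}     f _          = sum-replicate-zero n
  sum-∈ {x ∷ xs} f (x∉ ∷ !xs) = begin
    sum (λ i → [ does (i ∈? (x ∷ xs)) ]· f i)
      ≡⟨ sum-cong-≗ split ⟩
    sum (λ i → [ does (i ≟ x) ]· f i + [ does (i ∈? xs) ]· f i)
      ≡⟨ ∑-distrib-+ (λ i → [ does (i ≟ x) ]· f i) (λ i → [ does (i ∈? xs) ]· f i) ⟩
    sum (λ i → [ does (i ≟ x) ]· f i) + sum (λ i → [ does (i ∈? xs) ]· f i)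
      ≡⟨ cong₂ _+_ (sum-δ x f) (sum-∈ f !xs) ⟩
    f x + Σₗ f xs ∎
    where
    open ≡-Reasoning
    split : ∀ i → [ does (i ∈? (x ∷ xs)) ]· f i ≡ [ does (i ≟ x) ]· f i + [ does (i ∈? xs) ]· f i
    split i with i ≟ x
    ... | yes refl rewrite dec-false (i ∈? xs) (λ i∈xs → All.lookup x∉ i∈xs refl) =
      sym (+-identityʳ (f i))
    ... | no _     = sym (+-identityˡ _)

crosses : ∀ {n} → Subset n → Fin n → Fin n → Bool
crosses S u v = lookup S u ∧ lookup (∁ S) v

module _ {n : ℕ} (G : WGraph n) where

  deg-nonNeg : ∀ u → 0ℚ ≤ deg G u
  deg-nonNeg u = Σ[]-nonNeg (w-nonneg G u)

  volS≤volG : ∀ S → volS G S ≤ volG G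
  volS≤volG S = Σ[]-mono-≤ (λ u → []·-≤ (lookup S u) (deg-nonNeg u))

  wST-∁≤volS : ∀ S → wST G S (∁ S) ≤ volS G S
  wST-∁≤volS S = Σ[]-mono-≤ λ u →
    []·-mono-≤ (lookup S u) (Σ[]-mono-≤ λ v → []·-≤ (lookup (∁ S) v) (w-nonneg G u v))

  conductance≤1 : ∀ {φ} → IsConductance G φ → φ ≤ 1ℚ
  conductance≤1 (_ , S , _ , 0<volS , φvolS≡cut) =
    *-cancelʳ-≤-pos (volS G S) {{positive 0<volS}}
      (subst₂ _≤_ (sym φvolS≡cut) (sym (*-identityˡ (volS G S))) (wST-∁≤volS S))

  wST-∁≡sum-crosses : ∀ S → wST G S (∁ S) ≡ sum (λ u → sum (λ v → [ crosses S u v ]· w G u v))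
  wST-∁≡sum-crosses S = trans (Σ[]≡sum {n} _) (sum-cong-≗ {n} λ u → begin
    [ lookup S u ]· Σ[ (λ v → [ lookup (∁ S) v ]· w G u v) ]
      ≡⟨ cong ([ lookup S u ]·_) (Σ[]≡sum {n} _) ⟩
    [ lookup S u ]· sum (λ v → [ lookup (∁ S) v ]· w G u v)
      ≡⟨ []·-sum {n} (lookup S u) _ ⟩
    sum (λ v → [ lookup S u ]· [ lookup (∁ S) v ]· w G u v)
      ≡⟨ sum-cong-≗ {n} (λ v → []·-∧ (lookup S u) (lookup (∁ S) v) (w G u v)) ⟩
    sum (λ v → [ crosses S u v ]· w G u v) ∎)
    where open ≡-Reasoning

  Σₗ-cuts≡sum-w*charge : {A : Set} (c : A → ℚ) (S : A → Subset n) (xs : List A) →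
                         Σₗ (λ x → c x * wST G (S x) (∁ (S x))) xs ≡
                         sum (λ u → sum (λ v → w G u v * Σₗ (λ x → [ crosses (S x) u v ]· c x) xs))
  Σₗ-cuts≡sum-w*charge c S xs = begin
    Σₗ (λ x → c x * wST G (S x) (∁ (S x))) xs
      ≡⟨ Σₗ-cong xs (λ x → cong (c x *_) (wST-∁≡sum-crosses (S x))) ⟩
    Σₗ (λ x → c x * sum (λ u → sum (λ v → [ crosses (S x) u v ]· w G u v))) xs
      ≡⟨ Σₗ-cong xs (λ x → trans (*-distribˡ-sum {n} (c x) _)
                                 (sum-cong-≗ {n} λ u → *-distribˡ-sum {n} (c x) _)) ⟩
    Σₗ (λ x → sum (λ u → sum (λ v → c x * [ crosses (S x) u v ]· w G u v))) xs
      ≡⟨ Σₗ-sum-comm {n = n} _ xs ⟩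
    sum (λ u → Σₗ (λ x → sum (λ v → c x * [ crosses (S x) u v ]· w G u v)) xs)
      ≡⟨ sum-cong-≗ {n} (λ u → Σₗ-sum-comm {n = n} _ xs) ⟩
    sum (λ u → sum (λ v → Σₗ (λ x → c x * [ crosses (S x) u v ]· w G u v) xs))
      ≡⟨ sum-cong-≗ {n} (λ u → sum-cong-≗ {n} λ v → trans
           (Σₗ-cong xs (λ x → *-[]·-comm (c x) (crosses (S x) u v) (w G u v)))
           (sym (*-distribˡ-Σₗ (w G u v) _ xs))) ⟩
    sum (λ u → sum (λ v → w G u v * Σₗ (λ x → [ crosses (S x) u v ]· c x) xs)) ∎
    where open ≡-Reasoning

Unique-++⁻ : {A : Set} (xs : List A) {ys : List A} → Unique (xs ++ ys) →
             Unique xs × Unique ys × Disjoint xs ys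
Unique-++⁻ []       !ys = [] , !ys , λ ()
Unique-++⁻ (x ∷ xs) (x∉ ∷ !xs++ys) with Unique-++⁻ xs !xs++ys
... | !xs , !ys , xs#ys = All.++⁻ˡ xs x∉ ∷ !xs , !ys , λ where
  (here refl  , v∈ys) → All.lookup (All.++⁻ʳ xs x∉) v∈ys refl
  (there v∈xs , v∈ys) → xs#ys (v∈xs , v∈ys)

module _ {n : ℕ} where

  open DecMembership (_≟_ {n}) using (_∈?_)

  infix 4 _⊑_

  data _⊑_ : Tree n → Tree n → Set where
    ⊑-refl  : ∀ {X} → X ⊑ X
    ⊑-left  : ∀ {X l r} → X ⊑ l → X ⊑ node l r
    ⊑-right : ∀ {X l r} → X ⊑ r → X ⊑ node l r

  data ChildOf (B : Tree n) : Tree n → Set where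
    leftChild  : ∀ r → ChildOf B (node B r)
    rightChild : ∀ l → ChildOf B (node l B)

  ⊑-trans : ∀ {X Y Z} → X ⊑ Y → Y ⊑ Z → X ⊑ Z
  ⊑-trans X⊑Y ⊑-refl      = X⊑Y
  ⊑-trans X⊑Y (⊑-left p)  = ⊑-left (⊑-trans X⊑Y p)
  ⊑-trans X⊑Y (⊑-right p) = ⊑-right (⊑-trans X⊑Y p)

  child⇒⊑ : ∀ {B A} → ChildOf B A → B ⊑ A
  child⇒⊑ (leftChild r)  = ⊑-left ⊑-refl
  child⇒⊑ (rightChild l) = ⊑-right ⊑-refl

  ⊑-∈ : ∀ {X Y u} → X ⊑ Y → u ∈ leaves X → u ∈ leaves Y
  ⊑-∈ ⊑-refl                    u∈X = u∈X
  ⊑-∈ (⊑-left p)                u∈X = ∈-++⁺ˡ (⊑-∈ p u∈X)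
  ⊑-∈ (⊑-right {l = l} p)       u∈X = ∈-++⁺ʳ (leaves l) (⊑-∈ p u∈X)

  Unique-left : ∀ (l r : Tree n) → Unique (leaves (node l r)) → Unique (leaves l)
  Unique-left l r !lr = proj₁ (Unique-++⁻ (leaves l) !lr)

  Unique-right : ∀ (l r : Tree n) → Unique (leaves (node l r)) → Unique (leaves r)
  Unique-right l r !lr = proj₁ (proj₂ (Unique-++⁻ (leaves l) !lr))

  children-disjoint : ∀ (l r : Tree n) → Unique (leaves (node l r)) → Disjoint (leaves l) (leaves r)
  children-disjoint l r !lr = proj₂ (proj₂ (Unique-++⁻ (leaves l) !lr))

  ⊑-Unique : ∀ {X Y} → X ⊑ Y → Unique (leaves Y) → Unique (leaves X)
  ⊑-Unique ⊑-refl                  !Y = !Y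
  ⊑-Unique (⊑-left {l = l} {r} p)  !Y = ⊑-Unique p (Unique-left l r !Y)
  ⊑-Unique (⊑-right {l = l} {r} p) !Y = ⊑-Unique p (Unique-right l r !Y)

  size-left : ∀ (l r : Tree n) → size l ℕ.≤ size (node l r)
  size-left l r = ℕ.≤-trans (ℕ.m≤m+n (size l) (size r)) (ℕ.≤-reflexive (sym (length-++ (leaves l))))

  size-right : ∀ (l r : Tree n) → size r ℕ.≤ size (node l r)
  size-right l r = ℕ.≤-trans (ℕ.m≤n+m (size r) (size l)) (ℕ.≤-reflexive (sym (length-++ (leaves l))))

  ⊑-size : ∀ {X Y} → X ⊑ Y → size X ℕ.≤ size Y
  ⊑-size ⊑-refl                  = ℕ.≤-refl
  ⊑-size (⊑-left {l = l} {r} p)  = ℕ.≤-trans (⊑-size p) (size-left l r)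
  ⊑-size (⊑-right {l = l} {r} p) = ℕ.≤-trans (⊑-size p) (size-right l r)

  disjoint-⊑ : ∀ {xs Y Y′} → Disjoint xs (leaves Y) → Y′ ⊑ Y → Disjoint xs (leaves Y′)
  disjoint-⊑ xs#Y Y′⊑Y (u∈xs , u∈Y′) = xs#Y (u∈xs , ⊑-∈ Y′⊑Y u∈Y′)

  leaves-nonempty : ∀ (X : Tree n) → ∃ λ u → u ∈ leaves X
  leaves-nonempty (leaf x)   = x , here refl
  leaves-nonempty (node l r) with leaves-nonempty l
  ... | u , u∈l = u , ∈-++⁺ˡ u∈l

  size-pos : ∀ (X : Tree n) → 1 ℕ.≤ size X
  size-pos (leaf x)   = ℕ.≤-refl
  size-pos (node l r) = ℕ.≤-trans (size-pos l) (size-left l r)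

  Both : Tree n → Fin n → Fin n → Set
  Both X u v = u ∈ leaves X × v ∈ leaves X

  lcaSize-left : ∀ l r {u v} → Both l u v → lcaSize (node l r) u v ≡ lcaSize l u v
  lcaSize-left l r {u} {v} (u∈l , v∈l)
    with u ∈? leaves l | v ∈? leaves l | u ∈? leaves r | v ∈? leaves r
  ... | yes _ | yes _   | _ | _ = refl
  ... | no u∉l | _      | _ | _ = ⊥-elim (u∉l u∈l)
  ... | yes _ | no v∉l  | _ | _ = ⊥-elim (v∉l v∈l)

  lcaSize-right : ∀ l r {u v} → ¬ Both l u v → Both r u v → lcaSize (node l r) u v ≡ lcaSize r u v
  lcaSize-right l r {u} {v} ¬l (u∈r , v∈r)
    with u ∈? leaves l | v ∈? leaves l | u ∈? leaves r | v ∈? leaves r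
  ... | yes u∈l | yes v∈l | _       | _       = ⊥-elim (¬l (u∈l , v∈l))
  ... | _       | _       | no u∉r  | _       = ⊥-elim (u∉r u∈r)
  ... | _       | _       | yes _   | no v∉r  = ⊥-elim (v∉r v∈r)
  ... | no _    | _       | yes _   | yes _   = refl
  ... | yes _   | no _    | yes _   | yes _   = refl

  lcaSize-split : ∀ l r {u v} → ¬ Both l u v → ¬ Both r u v → lcaSize (node l r) u v ≡ size (node l r)
  lcaSize-split l r {u} {v} ¬l ¬r
    with u ∈? leaves l | v ∈? leaves l | u ∈? leaves r | v ∈? leaves r
  ... | yes u∈l | yes v∈l | _       | _       = ⊥-elim (¬l (u∈l , v∈l))
  ... | no _    | _       | yes u∈r | yes v∈r = ⊥-elim (¬r (u∈r , v∈r))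
  ... | yes _   | no _    | yes u∈r | yes v∈r = ⊥-elim (¬r (u∈r , v∈r))
  ... | no _    | _       | no _    | _       = refl
  ... | no _    | _       | yes _   | no _    = refl
  ... | yes _   | no _    | no _    | _       = refl
  ... | yes _   | no _    | yes _   | no _    = refl

  ¬Both-left : ∀ l r {u v} → Unique (leaves (node l r)) → u ∈ leaves r → ¬ Both l u v
  ¬Both-left l r !lr u∈r (u∈l , _) = children-disjoint l r !lr (u∈l , u∈r)

  ¬Both-right : ∀ l r {u v} → Unique (leaves (node l r)) → u ∈ leaves l → ¬ Both r u v
  ¬Both-right l r !lr u∈l (u∈r , _) = children-disjoint l r !lr (u∈l , u∈r)

  both? : ∀ X u v → Dec (Both X u v)
  both? X u v = (u ∈? leaves X) ×-dec (v ∈? leaves X)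

  lcaSize-sym : ∀ X u v → lcaSize X u v ≡ lcaSize X v u
  lcaSize-sym (leaf x)   u v = refl
  lcaSize-sym (node l r) u v with both? l u v | both? r u v
  ... | yes inl | _ = begin
    lcaSize (node l r) u v ≡⟨ lcaSize-left l r inl ⟩
    lcaSize l u v          ≡⟨ lcaSize-sym l u v ⟩
    lcaSize l v u          ≡⟨ lcaSize-left l r (swap inl) ⟨
    lcaSize (node l r) v u ∎
    where open ≡-Reasoning
  ... | no ¬l | yes inr = begin
    lcaSize (node l r) u v ≡⟨ lcaSize-right l r ¬l inr ⟩
    lcaSize r u v          ≡⟨ lcaSize-sym r u v ⟩
    lcaSize r v u          ≡⟨ lcaSize-right l r (¬l ∘ swap) (swap inr) ⟨
    lcaSize (node l r) v u ∎
    where open ≡-Reasoning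
  ... | no ¬l | no ¬r =
    trans (lcaSize-split l r ¬l ¬r) (sym (lcaSize-split l r (¬l ∘ swap) (¬r ∘ swap)))

  lcaSize-pos : ∀ X u v → 1 ℕ.≤ lcaSize X u v
  lcaSize-pos (leaf x)   u v = ℕ.≤-refl
  lcaSize-pos (node l r) u v with both? l u v | both? r u v
  ... | yes inl | _       rewrite lcaSize-left l r inl        = lcaSize-pos l u v
  ... | no ¬l   | yes inr rewrite lcaSize-right l r ¬l inr    = lcaSize-pos r u v
  ... | no ¬l   | no ¬r   rewrite lcaSize-split l r ¬l ¬r     = size-pos (node l r)

  lcaSize-cut : ∀ {A B u v} → Unique (leaves A) → ChildOf B A → u ∈ leaves B → v ∉ leaves B →
                lcaSize A u v ≡ size A
  lcaSize-cut {B = B} !A (leftChild r)  u∈B v∉B =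
    lcaSize-split B r (v∉B ∘ proj₂) (¬Both-right B r !A u∈B)
  lcaSize-cut {B = B} !A (rightChild l) u∈B v∉B =
    lcaSize-split l B (¬Both-left l B !A u∈B) (v∉B ∘ proj₂)

  size≤lcaSize-⊑ : ∀ {A T u v} → Unique (leaves T) → A ⊑ T → u ∈ leaves A →
                   size A ℕ.≤ lcaSize A u v → size A ℕ.≤ lcaSize T u v
  size≤lcaSize-⊑ _ ⊑-refl _ A≤lca = A≤lca
  size≤lcaSize-⊑ {T = node l r} {u} {v} !T (⊑-left p) u∈A A≤lca with toSum (v ∈? leaves l)
  ... | inj₁ v∈l rewrite lcaSize-left l r (⊑-∈ p u∈A , v∈l) =
    size≤lcaSize-⊑ (Unique-left l r !T) p u∈A A≤lca
  ... | inj₂ v∉l rewrite lcaSize-cut !T (leftChild {l} r) (⊑-∈ p u∈A) v∉l =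
    ⊑-size (⊑-left {r = r} p)
  size≤lcaSize-⊑ {T = node l r} {u} {v} !T (⊑-right p) u∈A A≤lca with toSum (v ∈? leaves r)
  ... | inj₁ v∈r rewrite lcaSize-right l r (¬Both-left l r !T (⊑-∈ p u∈A)) (⊑-∈ p u∈A , v∈r) =
    size≤lcaSize-⊑ (Unique-right l r !T) p u∈A A≤lca
  ... | inj₂ v∉r rewrite lcaSize-cut !T (rightChild {r} l) (⊑-∈ p u∈A) v∉r =
    ⊑-size (⊑-right {l = l} p)

  size≤lcaSize-cut : ∀ {T A B u v} → Unique (leaves T) → A ⊑ T → ChildOf B A →
                     u ∈ leaves B → v ∉ leaves B → size A ℕ.≤ lcaSize T u v
  size≤lcaSize-cut !T A⊑T B≺A u∈B v∉B =
    size≤lcaSize-⊑ !T A⊑T (⊑-∈ (child⇒⊑ B≺A) u∈B)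
      (ℕ.≤-reflexive (sym (lcaSize-cut (⊑-Unique A⊑T !T) B≺A u∈B v∉B)))

  child-proper : ∀ {A B} → Unique (leaves A) → ChildOf B A → ∃ λ u → u ∉ leaves B
  child-proper {B = B} !A (leftChild r) with leaves-nonempty r
  ... | u , u∈r = u , λ u∈B → children-disjoint B r !A (u∈B , u∈r)
  child-proper {B = B} !A (rightChild l) with leaves-nonempty l
  ... | u , u∈l = u , λ u∈B → children-disjoint l B !A (u∈l , u∈B)

  leafSet : Tree n → Subset n
  leafSet B = tabulate (λ u → does (u ∈? leaves B))

  lookup-leafSet : ∀ B u → lookup (leafSet B) u ≡ does (u ∈? leaves B)
  lookup-leafSet B u = lookup∘tabulate (λ u → does (u ∈? leaves B)) u

  ∈-leafSet : ∀ {B u} → u ∈ leaves B → u ∈ₛ leafSet B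
  ∈-leafSet {B} {u} u∈B =
    lookup⇒[]= u (leafSet B) (trans (lookup-leafSet B u) (dec-true (u ∈? leaves B) u∈B))

  ∉-leafSet : ∀ {B u} → u ∉ leaves B → u ∈ₛ ∁ (leafSet B)
  ∉-leafSet {B} {u} u∉B = lookup⇒[]= u (∁ (leafSet B)) (trans (lookup-map u not (leafSet B))
    (cong not (trans (lookup-leafSet B u) (dec-false (u ∈? leaves B) u∉B))))

  crosses-leafSet : ∀ B u v → crosses (leafSet B) u v ≡ does (u ∈? leaves B) ∧ not (does (v ∈? leaves B))
  crosses-leafSet B u v =
    cong₂ _∧_ (lookup-leafSet B u) (trans (lookup-map v not (leafSet B)) (cong not (lookup-leafSet B v)))

  crossing-outside : ∀ B {u} v x → u ∉ leaves B → [ crosses (leafSet B) u v ]· x ≡ 0ℚ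
  crossing-outside B {u} v x u∉B rewrite crosses-leafSet B u v | dec-false (u ∈? leaves B) u∉B = refl

  crossing-≤ : ∀ B u v {x y} → 0ℚ ≤ y → (u ∈ leaves B → v ∉ leaves B → x ≤ y) →
               [ crosses (leafSet B) u v ]· x ≤ y
  crossing-≤ B u v 0≤y x≤y rewrite crosses-leafSet B u v with u ∈? leaves B | v ∈? leaves B
  ... | no _    | _      = 0≤y
  ... | yes _   | yes _  = 0≤y
  ... | yes u∈B | no v∉B = x≤y u∈B v∉B

  data CutOf (T : Tree n) : Tree n × Tree n → Set where
    cut : ∀ {A B} → A ⊑ T → ChildOf B A → CutOf T (A , B)

  DisjointCuts : Tree n → List (Tree n × Tree n) → Set
  DisjointCuts T ps = All (CutOf T) ps × AllPairs (Disjoint on (leaves ∘ proj₂)) ps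

  cut-Unique : ∀ {T A B} → Unique (leaves T) → CutOf T (A , B) → Unique (leaves B)
  cut-Unique !T (cut A⊑T B≺A) = ⊑-Unique (⊑-trans (child⇒⊑ B≺A) A⊑T) !T

  cutCharge : List (Tree n × Tree n) → Fin n → Fin n → ℚ
  cutCharge ps u v = Σₗ (λ p → [ crosses (leafSet (proj₂ p)) u v ]· ℕ→ℚ (size (proj₁ p))) ps

  cutCharge-outside : ∀ {ps u} v → All (λ p → u ∉ leaves (proj₂ p)) ps → cutCharge ps u v ≡ 0ℚ
  cutCharge-outside v [] = refl
  cutCharge-outside {(A , B) ∷ ps} v (u∉B ∷ u∉ps) =
    trans (cong₂ _+_ (crossing-outside B v (ℕ→ℚ (size A)) u∉B) (cutCharge-outside v u∉ps))
          (+-identityʳ 0ℚ)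

  -- The B's are disjoint, so at most one cut (A, B) has u ∈ B; if moreover v ∉ B, then
  -- the lowest common ancestor of u and v lies at or above A.
  cutCharge≤lcaSize : ∀ {T ps} → Unique (leaves T) → DisjointCuts T ps →
                      ∀ u v → cutCharge ps u v ≤ ℕ→ℚ (lcaSize T u v)
  cutCharge≤lcaSize {T} !T ([] , []) u v = ℕ→ℚ-nonNeg (lcaSize T u v)
  cutCharge≤lcaSize {T} {(A , B) ∷ ps} !T (cut A⊑T B≺A ∷ cuts , B#ps ∷ disjoint) u v
    with toSum (u ∈? leaves B)
  ... | inj₁ u∈B = begin
    term + cutCharge ps u v ≡⟨ cong (term +_) (cutCharge-outside v u∉ps) ⟩
    term + 0ℚ               ≡⟨ +-identityʳ term ⟩
    term                    ≤⟨ crossing-≤ B u v (ℕ→ℚ-nonNeg (lcaSize T u v)) (λ u∈B v∉B →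
                                 ℕ→ℚ-mono-≤ (size≤lcaSize-cut !T A⊑T B≺A u∈B v∉B)) ⟩
    ℕ→ℚ (lcaSize T u v)    ∎
    where
    open ≤-Reasoning
    term : ℚ
    term = [ crosses (leafSet B) u v ]· ℕ→ℚ (size A)
    u∉ps : All (λ p → u ∉ leaves (proj₂ p)) ps
    u∉ps = All.map (λ B#B′ u∈B′ → B#B′ (u∈B , u∈B′)) B#ps
  ... | inj₂ u∉B = begin
    [ crosses (leafSet B) u v ]· ℕ→ℚ (size A) + cutCharge ps u v
      ≡⟨ cong (_+ cutCharge ps u v) (crossing-outside B v (ℕ→ℚ (size A)) u∉B) ⟩
    0ℚ + cutCharge ps u v
      ≡⟨ +-identityˡ (cutCharge ps u v) ⟩
    cutCharge ps u v
      ≤⟨ cutCharge≤lcaSize !T (cuts , disjoint) u v ⟩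
    ℕ→ℚ (lcaSize T u v) ∎
    where open ≤-Reasoning

module _ {n : ℕ} (G : WGraph n) where

  open DecMembership (_≟_ {n}) using (_∈?_)

  sum-w*lcaSize≡2cost : ∀ T → sum (λ u → sum (λ v → w G u v * ℕ→ℚ (lcaSize T u v))) ≡
                              cost G T + cost G T
  sum-w*lcaSize≡2cost T = trans (sum-symmetric W W-sym W-diag) (sym (cong₂ _+_ cost≡ cost≡))
    where
    W : Fin n → Fin n → ℚ
    W u v = w G u v * ℕ→ℚ (lcaSize T u v)
    W-sym : ∀ u v → W u v ≡ W v u
    W-sym u v = cong₂ (λ x k → x * ℕ→ℚ k) (w-sym G u v) (lcaSize-sym T u v)
    W-diag : ∀ u → W u u ≡ 0ℚ
    W-diag u = trans (cong (_* ℕ→ℚ (lcaSize T u u)) (w-noloop G u)) (*-zeroˡ (ℕ→ℚ (lcaSize T u u)))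
    cost≡ : cost G T ≡ sum (λ u → sum (λ v → [ toℕ u ℕ.<ᵇ toℕ v ]· W u v))
    cost≡ = trans (Σ[]≡sum {n} _)
                  (sum-cong-≗ {n} (λ u → Σ[]≡sum (λ v → [ toℕ u ℕ.<ᵇ toℕ v ]· W u v)))

  Σₗ-cuts≤2cost : {A : Set} (c : A → ℚ) (S : A → Subset n) (xs : List A) (T : Tree n) →
                  (∀ u v → Σₗ (λ x → [ crosses (S x) u v ]· c x) xs ≤ ℕ→ℚ (lcaSize T u v)) →
                  Σₗ (λ x → c x * wST G (S x) (∁ (S x))) xs ≤ cost G T + cost G T
  Σₗ-cuts≤2cost c S xs T charge≤lca = begin
    Σₗ (λ x → c x * wST G (S x) (∁ (S x))) xs
      ≡⟨ Σₗ-cuts≡sum-w*charge G c S xs ⟩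
    sum (λ u → sum (λ v → w G u v * Σₗ (λ x → [ crosses (S x) u v ]· c x) xs))
      ≤⟨ sum-mono-≤ (λ u → sum-mono-≤ λ v → *-monoˡ-≤-0≤ (w-nonneg G u v) (charge≤lca u v)) ⟩
    sum (λ u → sum (λ v → w G u v * ℕ→ℚ (lcaSize T u v)))
      ≡⟨ sum-w*lcaSize≡2cost T ⟩
    cost G T + cost G T ∎
    where open ≤-Reasoning

  volG≤2cost : ∀ T → volG G ≤ cost G T + cost G T
  volG≤2cost T = begin
    volG G
      ≡⟨ trans (Σ[]≡sum (deg G)) (sum-cong-≗ {n} (λ u → Σ[]≡sum (w G u))) ⟩
    sum (λ u → sum (λ v → w G u v))
      ≡⟨ sum-cong-≗ {n} (λ u → sum-cong-≗ {n} λ v → sym (*-identityʳ (w G u v))) ⟩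
    sum (λ u → sum (λ v → w G u v * ℕ→ℚ 1))
      ≤⟨ sum-mono-≤ (λ u → sum-mono-≤ λ v →
           *-monoˡ-≤-0≤ (w-nonneg G u v) (ℕ→ℚ-mono-≤ (lcaSize-pos T u v))) ⟩
    sum (λ u → sum (λ v → w G u v * ℕ→ℚ (lcaSize T u v)))
      ≡⟨ sum-w*lcaSize≡2cost T ⟩
    cost G T + cost G T ∎
    where open ≤-Reasoning

  volS-leafSet : ∀ B → Unique (leaves B) → volS G (leafSet B) ≡ volT G B
  volS-leafSet B !B = begin
    volS G (leafSet B)
      ≡⟨ Σ[]≡sum {n} _ ⟩
    sum (λ u → [ lookup (leafSet B) u ]· deg G u)
      ≡⟨ sum-cong-≗ {n} (λ u → cong ([_]· deg G u) (lookup-leafSet B u)) ⟩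
    sum (λ u → [ does (u ∈? leaves B) ]· deg G u)
      ≡⟨ sum-∈ (deg G) !B ⟩
    volT G B ∎
    where open ≡-Reasoning

  volT-node : ∀ l r → volT G (node l r) ≡ volT G l + volT G r
  volT-node l r = Σₗ-++ (deg G) (leaves l) (leaves r)

  volT≤volG : ∀ X → Unique (leaves X) → volT G X ≤ volG G
  volT≤volG X !X = subst (_≤ volG G) (volS-leafSet X !X) (volS≤volG G (leafSet X))

  Light : Tree n → Set
  Light X = ℕ→ℚ 2 * volT G X ≤ volG G

  light-cut-admissible : ∀ {T A B} → Unique (leaves T) → CutOf T (A , B) → Light B →
                         Admissible G (leafSet B)
  light-cut-admissible {B = B} !T (cut A⊑T B≺A) light = inside , outside , volume
    where
    inside : Nonempty (leafSet B)
    inside with leaves-nonempty B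
    ... | u , u∈B = u , ∈-leafSet {B = B} u∈B
    outside : Nonempty (∁ (leafSet B))
    outside with child-proper (⊑-Unique A⊑T !T) B≺A
    ... | u , u∉B = u , ∉-leafSet {B = B} u∉B
    volume : ℕ→ℚ 2 * volS G (leafSet B) ≤ volG G
    volume = subst (λ x → ℕ→ℚ 2 * x ≤ volG G)
                   (sym (volS-leafSet B (cut-Unique !T (cut A⊑T B≺A)))) light

  ½φ*branchSum≤cost : ∀ {φ T ps} → IsConductance G φ → Unique (leaves T) →
                      DisjointCuts T ps → All (Light ∘ proj₂) ps →
                      (½ * φ) * branchSum G ps ≤ cost G T
  ½φ*branchSum≤cost {φ} {T} {ps} (φ≤ratio , _) !T (cuts , disjoint) light =
    halve-≤ φ (branchSum G ps) (cost G T) (begin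
      φ * branchSum G ps
        ≡⟨ *-distribˡ-Σₗ φ _ ps ⟩
      Σₗ (λ p → φ * (ℕ→ℚ (size (proj₁ p)) * volT G (proj₂ p))) ps
        ≡⟨ Σₗ-cong ps (λ p → x∙yz≈y∙xz φ (ℕ→ℚ (size (proj₁ p))) (volT G (proj₂ p))) ⟩
      Σₗ (λ p → ℕ→ℚ (size (proj₁ p)) * (φ * volT G (proj₂ p))) ps
        ≤⟨ Σₗ-mono-≤ (All.zipWith cut-bound (cuts , light)) ⟩
      Σₗ (λ p → ℕ→ℚ (size (proj₁ p)) * wST G (leafSet (proj₂ p)) (∁ (leafSet (proj₂ p)))) ps
        ≤⟨ Σₗ-cuts≤2cost (ℕ→ℚ ∘ size ∘ proj₁) (leafSet ∘ proj₂) ps T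
                         (cutCharge≤lcaSize !T (cuts , disjoint)) ⟩
      cost G T + cost G T ∎)
    where
    open ≤-Reasoning
    cut-bound : ∀ {p} → CutOf T p × Light (proj₂ p) →
                ℕ→ℚ (size (proj₁ p)) * (φ * volT G (proj₂ p)) ≤
                ℕ→ℚ (size (proj₁ p)) * wST G (leafSet (proj₂ p)) (∁ (leafSet (proj₂ p)))
    cut-bound {A , B} (A,B-cut , light) =
      *-monoˡ-≤-0≤ (ℕ→ℚ-nonNeg (size A))
        (subst (λ x → φ * x ≤ wST G (leafSet B) (∁ (leafSet B)))
               (volS-leafSet B (cut-Unique !T A,B-cut))
               (φ≤ratio (leafSet B) (light-cut-admissible !T A,B-cut light)))

  LightChildren : Tree n → Set
  LightChildren (leaf _)   = ⊤
  LightChildren (node l r) = Light l × Light r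

  dense-cuts⊑ : ∀ {A ps Ak} → DenseFrom G A ps Ak → All (λ p → proj₂ p ⊑ A) ps
  dense-cuts⊑ (stop-leaf _ _)             = []
  dense-cuts⊑ (stop-node _ _ _ _ _)       = []
  dense-cuts⊑ (step-l _ _ _ _ _ _ _ dense) = ⊑-right ⊑-refl ∷ All.map ⊑-left (dense-cuts⊑ dense)
  dense-cuts⊑ (step-r _ _ _ _ _ _ _ dense) = ⊑-left ⊑-refl ∷ All.map ⊑-right (dense-cuts⊑ dense)

  dense-disjointCuts : ∀ {T A ps Ak} → Unique (leaves T) → A ⊑ T → DenseFrom G A ps Ak →
                       DisjointCuts T ps
  dense-disjointCuts !T A⊑T (stop-leaf _ _)       = [] , []
  dense-disjointCuts !T A⊑T (stop-node _ _ _ _ _) = [] , []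
  dense-disjointCuts !T A⊑T (step-l l r _ _ _ _ _ dense)
    with dense-disjointCuts !T (⊑-trans (⊑-left ⊑-refl) A⊑T) dense
  ... | cuts , disjoint =
    cut A⊑T (rightChild l) ∷ cuts ,
    All.map (disjoint-⊑ (Disjoint.sym (children-disjoint l r (⊑-Unique A⊑T !T)))) (dense-cuts⊑ dense)
      ∷ disjoint
  dense-disjointCuts !T A⊑T (step-r l r _ _ _ _ _ dense)
    with dense-disjointCuts !T (⊑-trans (⊑-right ⊑-refl) A⊑T) dense
  ... | cuts , disjoint =
    cut A⊑T (leftChild r) ∷ cuts ,
    All.map (disjoint-⊑ (children-disjoint l r (⊑-Unique A⊑T !T))) (dense-cuts⊑ dense) ∷ disjoint

  dense-cuts-light : ∀ {A ps Ak} → Unique (leaves A) → DenseFrom G A ps Ak → All (Light ∘ proj₂) ps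
  dense-cuts-light !A (stop-leaf _ _)       = []
  dense-cuts-light !A (stop-node _ _ _ _ _) = []
  dense-cuts-light !A (step-l l r _ _ _ r≤l _ dense) =
    x≤y⇒x+y≤z⇒2x≤z r≤l (subst (_≤ volG G) (trans (volT-node l r) (+-comm (volT G l) (volT G r)))
                                        (volT≤volG (node l r) !A))
    ∷ dense-cuts-light (Unique-left l r !A) dense
  dense-cuts-light !A (step-r l r _ _ _ l≤r _ dense) =
    x≤y⇒x+y≤z⇒2x≤z l≤r (subst (_≤ volG G) (volT-node l r) (volT≤volG (node l r) !A))
    ∷ dense-cuts-light (Unique-right l r !A) dense

  dense-last : ∀ {A ps Ak} → DenseFrom G A ps Ak → Ak ⊑ A × LightChildren Ak
  dense-last (stop-leaf _ _)                   = ⊑-refl , tt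
  dense-last (stop-node _ _ _ light-l light-r) = ⊑-refl , light-l , light-r
  dense-last (step-l _ _ _ _ _ _ _ dense) with dense-last dense
  ... | Ak⊑l , light = ⊑-left Ak⊑l , light
  dense-last (step-r _ _ _ _ _ _ _ dense) with dense-last dense
  ... | Ak⊑r , light = ⊑-right Ak⊑r , light

  ½φ*size*volT≤cost : ∀ {φ T A} → IsConductance G φ → Unique (leaves T) →
                      A ⊑ T → LightChildren A →
                      (½ * φ) * (ℕ→ℚ (size A) * volT G A) ≤ cost G T
  -- A leaf of the dense branch is too heavy to be admissible; Φ_G ≤ 1 is used instead.
  ½φ*size*volT≤cost {φ} {T} {leaf x} cond !T A⊑T tt =
    halve-≤ φ (ℕ→ℚ 1 * volT G (leaf x)) (cost G T) (begin
      φ * (ℕ→ℚ 1 * volT G (leaf x)) ≡⟨ cong (φ *_) (trans (*-identityˡ _) (+-identityʳ (deg G x))) ⟩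
      φ * deg G x                   ≤⟨ *-monoʳ-≤-nonNeg (deg G x) {{nonNegative (deg-nonNeg G x)}}
                                         (conductance≤1 G {φ} cond) ⟩
      1ℚ * deg G x                  ≡⟨ trans (*-identityˡ (deg G x)) (sym (+-identityʳ (deg G x))) ⟩
      volT G (leaf x)               ≤⟨ volT≤volG (leaf x) (⊑-Unique A⊑T !T) ⟩
      volG G                        ≤⟨ volG≤2cost T ⟩
      cost G T + cost G T           ∎)
    where open ≤-Reasoning
  ½φ*size*volT≤cost {φ} {T} {node l r} cond !T A⊑T (light-l , light-r) =
    subst (λ x → (½ * φ) * x ≤ cost G T) branchSum-children
      (½φ*branchSum≤cost {φ} cond !T cuts (light-l ∷ light-r ∷ []))
    where
    cuts : DisjointCuts T ((node l r , l) ∷ (node l r , r) ∷ [])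
    cuts = cut A⊑T (leftChild r) ∷ cut A⊑T (rightChild l) ∷ [] ,
           (children-disjoint l r (⊑-Unique A⊑T !T) ∷ []) ∷ [] ∷ []
    s : ℚ
    s = ℕ→ℚ (size (node l r))
    branchSum-children : branchSum G ((node l r , l) ∷ (node l r , r) ∷ []) ≡ s * volT G (node l r)
    branchSum-children = begin
      s * volT G l + (s * volT G r + 0ℚ) ≡⟨ cong (s * volT G l +_) (+-identityʳ (s * volT G r)) ⟩
      s * volT G l + s * volT G r        ≡⟨ *-distribˡ-+ s (volT G l) (volT G r) ⟨
      s * (volT G l + volT G r)          ≡⟨ cong (s *_) (volT-node l r) ⟨
      s * volT G (node l r)              ∎
      where open ≡-Reasoning

lemma3p6 : {n : ℕ} (G : WGraph n) (φ : ℚ) → IsConductance G φ →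
           (T : Tree n) → IsHCTree T →
           (ps : List (Tree n × Tree n)) (Ak : Tree n) → DenseBranch G T ps Ak →
           ((½ * φ) * branchSum G ps ≤ cost G T) ×
           ((½ * φ) * (ℕ→ℚ (size Ak) * volT G Ak) ≤ cost G T)
lemma3p6 G φ cond T (!T , _) ps Ak dense with dense-last G dense
... | Ak⊑T , light-children =
  ½φ*branchSum≤cost G {φ} cond !T (dense-disjointCuts G !T ⊑-refl dense) (dense-cuts-light G !T dense) ,
  ½φ*size*volT≤cost G {φ} cond !T Ak⊑T light-children
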